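{- Let $X$ be a set of variables and let $P$ be a B predicate in conjunctive form (CF). Then the predicate $P \Rightarrow T_X(P)$ is valid, where $T_X$ is the predicate abstraction defined in the context.
   Context: B predicates are first-order predicates over (typed) variables. A predicate is in conjunctive form (CF) if it is a conjunction $p_1\wedge\dots\wedge p_n$, where each $p_i$ is a disjunction $p_i^1\vee\dots\vee p_i^m$ and each $p_i^j$ is an elementary predicate of one of two shapes: (i) $E(Y)\ r\ F(Z)$, where $E(Y)$ is an expression whose variables form the set $Y$, $F(Z)$ is an expression whose variables form the set $Z$, and $r$ is a relational operator (e.g. $=,\neq,<,\in,\dots$); or (ii) $\forall z.Q$ or $\exists z.Q$, where $Q$ is a predicate in CF. For a set of variables $X$, the transformation $T_X$ on CF predicates is defined inductively by: - $T_X(E(Y)\ r\ F(Z)) = E(Y)\ r\ F(Z)$ if $Y\subseteq X$ and $Z\subseteq X$; - $T_X(E(Y)\ r\ F(Z)) = \mathit{true}$ if $Y\not\subseteq X$ or $Z\not\subseteq X$; - $T_X(P_1\vee P_2)=T_X(P_1)\vee T_X(P_2)$; - $T_X(P_1\wedge P_2)=T_X(P_1)\wedge T_X(P_2)$; - $T_X(\alpha z.P)=\alpha z.\,T_{X\cup\{z\}}(P)$ for $\alpha\in\{\forall,\exists\}$. -}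

module Defs where

open import Data.Bool using (Bool; true; false; _∧_; _∨_)
open import Data.List using (List; []; _∷_)
open import Data.Product using (Σ; _×_)
open import Data.Sum using (_⊎_)
open import Data.Unit using (⊤)
open import Relation.Nullary using (Dec; yes; no)
open import Relation.Nullary.Decidable using (⌊_⌋)
open import Relation.Binary.PropositionalEquality using (_≡_; refl)

record Language : Set₁ where
  field
    Var    : Set
    _≟_    : (x y : Var) → Dec (x ≡ y)
    Val    : Var → Set
    Expr   : Set
    vars   : Expr → List Var
    RelOp  : Set
    ⟦_⟧rel : Expr → RelOp → Expr → ((x : Var) → Val x) → Set

module Syntax (L : Language) where
  open Language L

  Env : Set
  Env = (x : Var) → Val x

  update : Env → (z : Var) → Val z → Env
  update ρ z v x with z ≟ x
  ... | yes refl = v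
  ... | no _     = ρ x

  data Pred : Set where
    ptrue  : Pred
    patom  : Expr → RelOp → Expr → Pred
    _por_  : Pred → Pred → Pred
    _pand_ : Pred → Pred → Pred
    _pimp_ : Pred → Pred → Pred
    pall   : Var → Pred → Pred
    pex    : Var → Pred → Pred

  ⟦_⟧ : Pred → Env → Set
  ⟦ ptrue ⟧ ρ       = ⊤
  ⟦ patom E r F ⟧ ρ = ⟦ E ⟧rel r F ρ
  ⟦ P por Q ⟧ ρ     = ⟦ P ⟧ ρ ⊎ ⟦ Q ⟧ ρ
  ⟦ P pand Q ⟧ ρ    = ⟦ P ⟧ ρ × ⟦ Q ⟧ ρ
  ⟦ P pimp Q ⟧ ρ    = ⟦ P ⟧ ρ → ⟦ Q ⟧ ρ
  ⟦ pall z P ⟧ ρ    = (v : Val z) → ⟦ P ⟧ (update ρ z v)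
  ⟦ pex z P ⟧ ρ     = Σ (Val z) λ v → ⟦ P ⟧ (update ρ z v)

  Valid : Pred → Set
  Valid P = (ρ : Env) → ⟦ P ⟧ ρ

  data CF : Set
  data Disj : Set
  data Elem : Set

  data CF where
    conj1 : Disj → CF
    conj  : Disj → CF → CF

  data Disj where
    disj1 : Elem → Disj
    disj  : Elem → Disj → Disj

  data Elem where
    atom : Expr → RelOp → Expr → Elem
    all  : Var → CF → Elem
    ex   : Var → CF → Elem

  ⌜_⌝c : CF → Pred
  ⌜_⌝d : Disj → Pred
  ⌜_⌝e : Elem → Pred
  ⌜ conj1 d ⌝c   = ⌜ d ⌝d
  ⌜ conj d p ⌝c  = ⌜ d ⌝d pand ⌜ p ⌝c
  ⌜ disj1 e ⌝d   = ⌜ e ⌝e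
  ⌜ disj e d ⌝d  = ⌜ e ⌝e por ⌜ d ⌝d
  ⌜ atom E r F ⌝e = patom E r F
  ⌜ all z Q ⌝e   = pall z ⌜ Q ⌝c
  ⌜ ex z Q ⌝e    = pex z ⌜ Q ⌝c

  VarSet : Set
  VarSet = Var → Bool

  insert : Var → VarSet → VarSet
  insert z X x = ⌊ z ≟ x ⌋ ∨ X x

  _⊆?_ : List Var → VarSet → Bool
  [] ⊆? X      = true
  (y ∷ Y) ⊆? X = X y ∧ (Y ⊆? X)

  T-cf   : VarSet → CF → Pred
  T-disj : VarSet → Disj → Pred
  T-elem : VarSet → Elem → Pred
  T-cf X (conj1 d)   = T-disj X d
  T-cf X (conj d p)  = T-disj X d pand T-cf X p
  T-disj X (disj1 e) = T-elem X e
  T-disj X (disj e d) = T-elem X e por T-disj X d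
  T-elem X (atom E r F) with vars E ⊆? X | vars F ⊆? X
  ... | true  | true  = patom E r F
  ... | true  | false = ptrue
  ... | false | _     = ptrue
  T-elem X (all z Q) = pall z (T-cf (insert z X) Q)
  T-elem X (ex z Q)  = pex z (T-cf (insert z X) Q)

-- T_X only replaces elementary predicates by true, and every connective
-- occurring in a CF predicate (∧, ∨, ∀, ∃) is monotone; so, by induction on
-- the CF syntax, a proof of P in any environment yields one of T_X(P).
module Submission where

open import Defs
open import Data.Bool using (true; false)
open import Data.Product using (_,_)
open import Data.Sum using (inj₁; inj₂)
open import Data.Unit using (tt)

module _ (L : Language) where
  open Language L
  open Syntax L

  cf⇒T-cf     : ∀ X P ρ → ⟦ ⌜ P ⌝c ⟧ ρ → ⟦ T-cf X P ⟧ ρ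
  disj⇒T-disj : ∀ X P ρ → ⟦ ⌜ P ⌝d ⟧ ρ → ⟦ T-disj X P ⟧ ρ
  elem⇒T-elem : ∀ X P ρ → ⟦ ⌜ P ⌝e ⟧ ρ → ⟦ T-elem X P ⟧ ρ

  cf⇒T-cf X (conj1 d)  ρ p       = disj⇒T-disj X d ρ p
  cf⇒T-cf X (conj d c) ρ (p , q) = disj⇒T-disj X d ρ p , cf⇒T-cf X c ρ q

  disj⇒T-disj X (disj1 e)  ρ p        = elem⇒T-elem X e ρ p
  disj⇒T-disj X (disj e d) ρ (inj₁ p) = inj₁ (elem⇒T-elem X e ρ p)
  disj⇒T-disj X (disj e d) ρ (inj₂ p) = inj₂ (disj⇒T-disj X d ρ p)

  elem⇒T-elem X (atom E r F) ρ p with vars E ⊆? X | vars F ⊆? X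
  ... | true  | true  = p
  ... | true  | false = tt
  ... | false | _     = tt
  elem⇒T-elem X (all z Q) ρ p v     = cf⇒T-cf (insert z X) Q (update ρ z v) (p v)
  elem⇒T-elem X (ex z Q)  ρ (v , p) = v , cf⇒T-cf (insert z X) Q (update ρ z v) p

mainTheorem1 : (L : Language) → let open Syntax L in
    (X : VarSet) (P : CF) → Valid (⌜ P ⌝c pimp T-cf X P)
mainTheorem1 L X P ρ = cf⇒T-cf L X P ρ
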